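{- For the metric on $\mathbb{R}^2$ induced by the $\ell_\infty$-norm, there exists a finite input set $X\subset\mathbb{R}^2$ and a $k$ (namely $k=4$, $|X|=8$) such that some run of the agglomerative complete linkage algorithm on $X$ computes a $k$-clustering whose diameter cost is three times the minimum diameter cost over all $k$-clusterings of $X$.
   Context: A $k$-clustering of a finite set $X$ is a partition into $k$ non-empty sets; $\mathrm{diam}(C)=\max_{x,y\in C}\|x-y\|_\infty$ and $\mathrm{diamcost}(\mathcal{C})=\max_{C\in\mathcal{C}}\mathrm{diam}(C)$. The agglomerative complete linkage algorithm starts with all singletons and, for $i=|X|-1,\ldots,1$, merges two distinct clusters $A,B$ of the current $(i+1)$-clustering minimizing $\mathrm{diam}(A\cup B)$, yielding $\mathcal{C}_i$. A "run" means an execution in which, whenever several pairs attain the minimum, any one of them may be chosen. -}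

module Defs where

open import Data.Nat using (ℕ; _≤_; _⊔_)
open import Data.Integer using (ℤ; ∣_∣; _-_)
open import Data.Product using (_×_; Σ; ∃; _,_)
open import Data.List using (List; []; _∷_; _++_; [_]; map; foldr; concat; length)
open import Data.List.Relation.Unary.All using (All)
open import Data.List.Relation.Binary.Permutation.Propositional using (_↭_)
open import Relation.Binary.PropositionalEquality using (_≡_)
open import Relation.Binary.Construct.Closure.ReflexiveTransitive using (Star)

Point : Set
Point = ℤ × ℤ

dist : Point → Point → ℕ
dist (x₁ , y₁) (x₂ , y₂) = ∣ x₁ - x₂ ∣ ⊔ ∣ y₁ - y₂ ∣

Cluster : Set
Cluster = List Point

Clustering : Set
Clustering = List Cluster

diam : Cluster → ℕ
diam C = foldr (λ x m → foldr (λ y n → dist x y ⊔ n) m C) 0 C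

diamcost : Clustering → ℕ
diamcost 𝒞 = foldr (λ C m → diam C ⊔ m) 0 𝒞

data NonEmpty {A : Set} : List A → Set where
  nonEmpty : ∀ x xs → NonEmpty (x ∷ xs)

-- 𝒞 is a k-clustering of X: k non-empty clusters that together partition X
-- (X is assumed duplicate-free where used).
IsClustering : ℕ → List Point → Clustering → Set
IsClustering k X 𝒞 = (length 𝒞 ≡ k) × All NonEmpty 𝒞 × (concat 𝒞 ↭ X)

-- One step of agglomerative complete linkage: 𝒞 consists of two distinct
-- clusters A , B (distinct positions) and the rest R; A ∪ B minimizes the
-- merged diameter among all pairs of distinct clusters; result is (A ∪ B) ∷ R.
Step : Clustering → Clustering → Set
Step 𝒞 𝒟 = Σ Cluster λ A → Σ Cluster λ B → Σ Clustering λ R →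
  (𝒞 ↭ A ∷ B ∷ R) ×
  (∀ A′ B′ R′ → 𝒞 ↭ A′ ∷ B′ ∷ R′ → diam (A ++ B) ≤ diam (A′ ++ B′)) ×
  (𝒟 ≡ (A ++ B) ∷ R)

singletons : List Point → Clustering
singletons X = map [_] X

-- 𝒞 is computed by some run of the algorithm on X (as an intermediate
-- clustering 𝒞_i, i = length 𝒞).
ComputedByRun : List Point → Clustering → Set
ComputedByRun X 𝒞 = Star Step (singletons X) 𝒞

{-# OPTIONS --safe #-}
-- The eight points split into four pairs at ℓ∞ distance 1, and distinct integer
-- points are at distance at least 1, so the optimal 4-clustering costs 1.
-- Complete linkage may break ties badly: it first merges the pairs
-- {(1,3),(2,3)} and {(2,1),(3,1)} at diameter 1, then has a tie at diameter 2
-- and joins these two clusters, after which every merge costs 3, and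
-- attaching (0,3) yields a 4-clustering of cost 3.
module Submission where

open import Defs
open import Data.Nat using (ℕ; _≤_; _*_)
open import Data.Product using (_×_; Σ)
open import Data.List using (List; length)
open import Data.List.Relation.Unary.Unique.Propositional using (Unique)
open import Relation.Binary.PropositionalEquality using (_≡_)

open import Data.Nat using (zero; suc; _<_; _≤?_; _<?_; s≤s)
open import Data.Nat.Properties
  using (m≤m⊔n; m≤n⊔m; ≤-trans; ≤-reflexive; n≤0⇒n≡0; <-trans; n<1+n; 0<1+n)
open import Data.Integer using (+_; _≟_)
open import Data.Integer.Properties using (∣i∣≡0⇒i≡0; i-j≡0⇒i≡j)
open import Data.Product using (_,_; proj₁)
open import Data.Product.Properties using (≡-dec)
open import Data.List using ([]; _∷_; _++_; [_]; concat)
import Data.List.Properties as List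
open import Data.List.Relation.Unary.All using ([]; _∷_)
open import Data.List.Relation.Unary.AllPairs using (AllPairs; _∷_; allPairs?)
open import Data.List.Relation.Binary.Permutation.Propositional
  using (_↭_; refl; prep; trans; swap; ↭-sym; ↭⇒↭ₛ)
open import Data.List.Relation.Binary.Permutation.Propositional.Properties using (↭-length)
import Data.List.Relation.Binary.Permutation.Setoid.Properties as Permutationₛ
import Data.List.Relation.Unary.Unique.DecSetoid as UniqueDec
open import Data.Maybe using (Maybe; just; nothing; is-just)
open import Data.Bool using (T)
open import Function using (_∘_)
open import Relation.Nullary using (Dec; yes; no; ¬_; contradiction)
open import Relation.Nullary.Decidable using (True; toWitness; from-yes; _×-dec_)
open import Relation.Binary.Definitions using (DecidableEquality; Symmetric)
open import Relation.Binary.PropositionalEquality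
  using (refl; sym; subst; cong₂; setoid; decSetoid; resp₂)
open import Relation.Binary.Construct.Closure.ReflexiveTransitive using (ε; _◅_)

module _ {A : Set} where

  AllPairs-resp-↭ : {R : A → A → Set} → Symmetric R →
                    ∀ {xs ys} → xs ↭ ys → AllPairs R xs → AllPairs R ys
  AllPairs-resp-↭ {R} symR xs↭ys =
    Permutationₛ.AllPairs-resp-↭ (setoid A) symR (resp₂ R) (↭⇒↭ₛ xs↭ys)

  module _ (_≟ₐ_ : DecidableEquality A) where

    select : (x : A) (ys : List A) → Maybe (Σ (List A) λ zs → ys ↭ x ∷ zs)
    select x [] = nothing
    select x (y ∷ ys) with x ≟ₐ y | select x ys
    ... | yes refl | _                  = just (ys , refl)
    ... | no _     | nothing            = nothing
    ... | no _     | just (zs , ys↭x∷zs) = just (y ∷ zs , trans (prep y ys↭x∷zs) (swap y x refl))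

    find-↭ : (xs ys : List A) → Maybe (xs ↭ ys)
    find-↭ [] [] = just refl
    find-↭ [] (_ ∷ _) = nothing
    find-↭ (x ∷ xs) ys with select x ys
    ... | nothing = nothing
    ... | just (zs , ys↭x∷zs) with find-↭ xs zs
    ...   | nothing    = nothing
    ...   | just xs↭zs = just (trans (prep x xs↭zs) (↭-sym ys↭x∷zs))

    found-↭ : ∀ xs ys → T (is-just (find-↭ xs ys)) → xs ↭ ys
    found-↭ xs ys found with find-↭ xs ys
    ... | just xs↭ys = xs↭ys

_≟ᵖ_ : DecidableEquality Point
_≟ᵖ_ = ≡-dec _≟_ _≟_

dist≡0⇒≡ : ∀ p q → dist p q ≡ 0 → p ≡ q
dist≡0⇒≡ (a , b) (c , d) d≡0 = cong₂ _,_
  (i-j≡0⇒i≡j a c (∣i∣≡0⇒i≡0 (n≤0⇒n≡0 (≤-trans (m≤m⊔n _ _) (≤-reflexive d≡0)))))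
  (i-j≡0⇒i≡j b d (∣i∣≡0⇒i≡0 (n≤0⇒n≡0 (≤-trans (m≤n⊔m _ _) (≤-reflexive d≡0)))))

≢⇒dist-pos : ∀ p q → ¬ p ≡ q → 0 < dist p q
≢⇒dist-pos p q p≢q with dist p q in d≡
... | zero  = contradiction (dist≡0⇒≡ p q d≡) p≢q
... | suc _ = 0<1+n

dist≤diam : ∀ p q rs → dist p q ≤ diam (p ∷ q ∷ rs)
dist≤diam p q rs =
  ≤-trans (m≤m⊔n (dist p q) _) (m≤n⊔m (dist p p) _)

diamcost-pos : ∀ 𝒟 → Unique (concat 𝒟) → length 𝒟 < length (concat 𝒟) → 0 < diamcost 𝒟
diamcost-pos ([] ∷ 𝒟) uniq more =
  ≤-trans (diamcost-pos 𝒟 uniq (<-trans (n<1+n _) more)) (m≤n⊔m 0 _)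
diamcost-pos ((p ∷ []) ∷ 𝒟) (_ ∷ uniq) (s≤s more) =
  ≤-trans (diamcost-pos 𝒟 uniq more) (m≤n⊔m (diam [ p ]) _)
diamcost-pos ((p ∷ q ∷ rs) ∷ 𝒟) ((p≢q ∷ _) ∷ _) _ =
  ≤-trans (≢⇒dist-pos p q p≢q) (≤-trans (dist≤diam p q rs) (m≤m⊔n _ _))

clustering-diamcost-pos : ∀ {k X 𝒟} → Unique X → k < length X → IsClustering k X 𝒟 → 0 < diamcost 𝒟
clustering-diamcost-pos {𝒟 = 𝒟} uniq k<|X| (refl , _ , ⋃𝒟↭X) =
  diamcost-pos 𝒟 (AllPairs-resp-↭ (λ p≢q → p≢q ∘ sym) (↭-sym ⋃𝒟↭X) uniq)
                 (subst (_ <_) (sym (↭-length ⋃𝒟↭X)) k<|X|)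

-- Both orders are recorded, diam (A ++ B) ≡ diam (B ++ A) not being definitional,
-- so that the relation is symmetric and AllPairs of it is invariant under ↭.
MergeDiam≥ : ℕ → Cluster → Cluster → Set
MergeDiam≥ m A B = m ≤ diam (A ++ B) × m ≤ diam (B ++ A)

mergeDiam≥? : ∀ m A B → Dec (MergeDiam≥ m A B)
mergeDiam≥? m A B = (m ≤? diam (A ++ B)) ×-dec (m ≤? diam (B ++ A))

minimal-merge-step : ∀ {𝒞} A B R → 𝒞 ↭ A ∷ B ∷ R →
                     AllPairs (MergeDiam≥ (diam (A ++ B))) 𝒞 → Step 𝒞 ((A ++ B) ∷ R)
minimal-merge-step {𝒞} A B R 𝒞↭ABR minimal =
  A , B , R , 𝒞↭ABR , (λ A′ B′ R′ 𝒞↭A′B′R′ → proj₁ (first-pair (reorder 𝒞↭A′B′R′))) , refl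
  where
  m : ℕ
  m = diam (A ++ B)
  swap× : ∀ {C D} → MergeDiam≥ m C D → MergeDiam≥ m D C
  swap× (≤CD , ≤DC) = ≤DC , ≤CD
  reorder : ∀ {𝒟} → 𝒞 ↭ 𝒟 → AllPairs (MergeDiam≥ m) 𝒟
  reorder 𝒞↭𝒟 = AllPairs-resp-↭ (λ {C D} → swap× {C} {D}) 𝒞↭𝒟 minimal
  first-pair : ∀ {C D 𝒟} → AllPairs (MergeDiam≥ m) (C ∷ D ∷ 𝒟) → MergeDiam≥ m C D
  first-pair ((≤CD ∷ _) ∷ _) = ≤CD

_≟ᶜ_ : DecidableEquality Cluster
_≟ᶜ_ = List.≡-dec _≟ᵖ_

checked-step : (𝒞 : Clustering) (A B : Cluster) (R : Clustering) →
               {found : T (is-just (find-↭ _≟ᶜ_ 𝒞 (A ∷ B ∷ R)))} →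
               {minimal : True (allPairs? (mergeDiam≥? (diam (A ++ B))) 𝒞)} →
               Step 𝒞 ((A ++ B) ∷ R)
checked-step 𝒞 A B R {found} {minimal} =
  minimal-merge-step A B R (found-↭ _≟ᶜ_ 𝒞 (A ∷ B ∷ R) found) (toWitness minimal)

pt : ℕ → ℕ → Point
pt a b = (+ a , + b)

X : List Point
X = pt 0 3 ∷ pt 1 0 ∷ pt 1 3 ∷ pt 2 1 ∷ pt 2 3 ∷ pt 3 1 ∷ pt 3 4 ∷ pt 4 0 ∷ []

𝒞₁ 𝒞₂ 𝒞₃ 𝒞₄ : Clustering
𝒞₁ = (pt 1 3 ∷ pt 2 3 ∷ []) ∷ [ pt 0 3 ] ∷ [ pt 1 0 ] ∷ [ pt 2 1 ] ∷ [ pt 3 1 ] ∷ [ pt 3 4 ] ∷ [ pt 4 0 ] ∷ []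
𝒞₂ = (pt 2 1 ∷ pt 3 1 ∷ []) ∷ (pt 1 3 ∷ pt 2 3 ∷ []) ∷ [ pt 0 3 ] ∷ [ pt 1 0 ] ∷ [ pt 3 4 ] ∷ [ pt 4 0 ] ∷ []
𝒞₃ = (pt 1 3 ∷ pt 2 3 ∷ pt 2 1 ∷ pt 3 1 ∷ []) ∷ [ pt 0 3 ] ∷ [ pt 1 0 ] ∷ [ pt 3 4 ] ∷ [ pt 4 0 ] ∷ []
𝒞₄ = (pt 0 3 ∷ pt 1 3 ∷ pt 2 3 ∷ pt 2 1 ∷ pt 3 1 ∷ []) ∷ [ pt 1 0 ] ∷ [ pt 3 4 ] ∷ [ pt 4 0 ] ∷ []

𝒪 : Clustering
𝒪 = (pt 0 3 ∷ pt 1 3 ∷ []) ∷ (pt 2 3 ∷ pt 3 4 ∷ []) ∷ (pt 2 1 ∷ pt 1 0 ∷ []) ∷ (pt 3 1 ∷ pt 4 0 ∷ []) ∷ []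

complete-linkage-run : ComputedByRun X 𝒞₄
complete-linkage-run =
      checked-step (singletons X) [ pt 1 3 ] [ pt 2 3 ]
        ([ pt 0 3 ] ∷ [ pt 1 0 ] ∷ [ pt 2 1 ] ∷ [ pt 3 1 ] ∷ [ pt 3 4 ] ∷ [ pt 4 0 ] ∷ [])
    ◅ checked-step 𝒞₁ [ pt 2 1 ] [ pt 3 1 ]
        ((pt 1 3 ∷ pt 2 3 ∷ []) ∷ [ pt 0 3 ] ∷ [ pt 1 0 ] ∷ [ pt 3 4 ] ∷ [ pt 4 0 ] ∷ [])
    ◅ checked-step 𝒞₂ (pt 1 3 ∷ pt 2 3 ∷ []) (pt 2 1 ∷ pt 3 1 ∷ [])
        ([ pt 0 3 ] ∷ [ pt 1 0 ] ∷ [ pt 3 4 ] ∷ [ pt 4 0 ] ∷ [])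
    ◅ checked-step 𝒞₃ [ pt 0 3 ] (pt 1 3 ∷ pt 2 3 ∷ pt 2 1 ∷ pt 3 1 ∷ [])
        ([ pt 1 0 ] ∷ [ pt 3 4 ] ∷ [ pt 4 0 ] ∷ [])
    ◅ ε

X-unique : Unique X
X-unique = from-yes (UniqueDec.unique? (decSetoid _≟ᵖ_) X)

𝒞₄-clustering : IsClustering 4 X 𝒞₄
𝒞₄-clustering = refl , nonEmpty _ _ ∷ nonEmpty _ _ ∷ nonEmpty _ _ ∷ nonEmpty _ _ ∷ [] ,
                found-↭ _≟ᵖ_ (concat 𝒞₄) X _

𝒪-clustering : IsClustering 4 X 𝒪
𝒪-clustering = refl , nonEmpty _ _ ∷ nonEmpty _ _ ∷ nonEmpty _ _ ∷ nonEmpty _ _ ∷ [] ,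
               found-↭ _≟ᵖ_ (concat 𝒪) X _

𝒪-optimal : ∀ 𝒟 → IsClustering 4 X 𝒟 → diamcost 𝒪 ≤ diamcost 𝒟
𝒪-optimal _ = clustering-diamcost-pos X-unique (from-yes (4 <? 8))

proposition5 : Σ (List Point) λ X → Unique X × length X ≡ 8 ×
    Σ Clustering λ 𝒞 → ComputedByRun X 𝒞 × IsClustering 4 X 𝒞 ×
      Σ Clustering λ 𝒪 → IsClustering 4 X 𝒪 ×
        (∀ 𝒟 → IsClustering 4 X 𝒟 → diamcost 𝒪 ≤ diamcost 𝒟) ×
        diamcost 𝒞 ≡ 3 * diamcost 𝒪
proposition5 =
  X , X-unique , refl ,
  𝒞₄ , complete-linkage-run , 𝒞₄-clustering ,
  𝒪 , 𝒪-clustering , 𝒪-optimal , refl
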